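{- Let $\mathsf{MSA}[1..m][1..n]$ be a multiple sequence alignment over $\Sigma\cup\{ -\}$, let $1\le x\le n$, and for each $1\le i\le m$ let $y_i$ be such that $\mathrm{spell}(\mathsf{MSA}[i][x..y_i])\in\Sigma^+$. Let $W=\{w_1,\dots,w_k\}$ be the set of (implicit or explicit) nodes of $\mathrm{GST}$ corresponding to the strings $\{\mathrm{spell}(\mathsf{MSA}[i][x..y_i]) : 1\le i\le m\}$. Then $\mathsf{MSA}[i][x..y_i]$ is semi-repeat-free for all $1\le i\le m$ if and only if $W$ covers exactly $m$ leaves of $\mathrm{GST}$.
   Context: A multiple sequence alignment $\mathsf{MSA}[1..m][1..n]$ is an $m\times n$ matrix whose rows are strings over $\Sigma\cup\{ -\}$, where $-\notin\Sigma$ is the gap symbol. For a string $X$ over $\Sigma\cup\{ -\}$, $\mathrm{spell}(X)$ is the string obtained by deleting all gap symbols from $X$. For a row $i'$ and column $x$, $g(i',x)$ denotes $x$ minus the number of gap symbols in $\mathsf{MSA}[i'][1..x]$. A substring $\mathsf{MSA}[i][x..y]$ with $\mathrm{spell}(\mathsf{MSA}[i][x..y])\in\Sigma^+$ is called semi-repeat-free if for every $1\le i'\le m$, the string $\mathrm{spell}(\mathsf{MSA}[i][x..y])$ occurs in the gaps-removed row $\mathrm{spell}(\mathsf{MSA}[i'][1..n])$ only at position $g(i',x)$ (or does not occur in it at all). $\mathrm{GST}$ is the generalized suffix tree of the set of strings $\{\mathrm{spell}(\mathsf{MSA}[i][1..n])\cdot \$_i : 1\le i\le m\}$, where $\$_1,\dots,\$_m$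 are $m$ distinct new terminator symbols not in $\Sigma$, i.e. the compacted trie of all suffixes of these strings; each leaf corresponds to exactly one such suffix. A string occurring in these strings corresponds to a (possibly implicit, i.e. lying inside an edge) node of the tree, reached by spelling it from the root; a node covers the leaves in its subtree (for an implicit node, the subtree of the explicit node ending the edge it lies on), i.e. the suffixes having that string as a prefix. -}

module Defs where

open import Data.Nat using (ℕ; zero; suc; _∸_)
open import Data.Fin using (Fin; toℕ)
open import Data.List using (List; []; _∷_; _++_; [_]; map; take; drop; length; upTo; allFin; filter; concatMap; tabulate)
open import Data.List.Relation.Binary.Prefix.Heterogeneous using (Prefix)
open import Data.List.Relation.Binary.Prefix.Heterogeneous.Properties using (prefix?)
open import Data.Fin.Properties using (any?) renaming (_≟_ to _≟F_)
open import Data.Product using (Σ; ∃; _×_; _,_)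
open import Relation.Binary.PropositionalEquality using (_≡_; _≢_)
open import Relation.Binary.Definitions using (DecidableEquality)
open import Relation.Nullary using (Dec; yes; no)

data Cell (A : Set) : Set where
  gap : Cell A
  sym : A → Cell A

-- An MSA[1..m][1..n] (rows and columns indexed 0-based by Fin).
MSA : Set → ℕ → ℕ → Set
MSA A m n = Fin m → Fin n → Cell A

spell : {A : Set} → List (Cell A) → List A
spell []          = []
spell (gap ∷ xs)   = spell xs
spell (sym a ∷ xs) = a ∷ spell xs

module _ {A : Set} {m n : ℕ} (M : MSA A m n) where

  row : Fin m → List (Cell A)
  row i = tabulate (M i)

  -- the substring MSA[i][x..y] (columns x..y inclusive; empty if y < x)
  segment : Fin m → Fin n → Fin n → List (Cell A)
  segment i x y = take (suc (toℕ y) ∸ toℕ x) (drop (toℕ x) (row i))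

  spellRow : Fin m → List A
  spellRow i' = spell (row i')

  -- 0-based position in spell(MSA[i'][1..n]) at which column x starts,
  -- i.e. the number of non-gap symbols in MSA[i'][1..x-1]
  -- (= g(i',x) - 1 when MSA[i'][x] is not a gap).
  startPos : Fin m → Fin n → ℕ
  startPos i' x = length (spell (take (toℕ x) (row i')))

OccursAt : {A : Set} → List A → List A → ℕ → Set
OccursAt S T p = Prefix _≡_ S (drop p T)

module _ {A : Set} {m n : ℕ} (M : MSA A m n) where

  SemiRepeatFree : Fin m → Fin n → Fin n → Set
  SemiRepeatFree i x y =
    (spell (segment M i x y) ≢ []) ×
    (∀ (i' : Fin m) (p : ℕ) → OccursAt (spell (segment M i x y)) (spellRow M i') p → p ≡ startPos M i' x)

-- Symbols of the GST texts: letters of Σ and the m distinct terminators $_1..$_m.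
data TSym (A : Set) (m : ℕ) : Set where
  chr  : A → TSym A m
  term : Fin m → TSym A m

module GST {A : Set} (_≟_ : DecidableEquality A) {m n : ℕ} (M : MSA A m n) where

  _≟T_ : DecidableEquality (TSym A m)
  chr a  ≟T chr b with a ≟ b
  ... | yes _≡_.refl = yes _≡_.refl
  ... | no ¬p = no λ { _≡_.refl → ¬p _≡_.refl }
  chr a  ≟T term j = no λ ()
  term i ≟T chr b = no λ ()
  term i ≟T term j with i ≟F j
  ... | yes _≡_.refl = yes _≡_.refl
  ... | no ¬p = no λ { _≡_.refl → ¬p _≡_.refl }

  text : Fin m → List (TSym A m)
  text i' = map chr (spellRow M i') ++ [ term i' ]

  -- leaves of GST: one per suffix, identified by (text index, 0-based start)
  Leaf : Set
  Leaf = Fin m × ℕ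

  leaves : List Leaf
  leaves = concatMap (λ i' → map (λ p → (i' , p)) (upTo (length (text i')))) (allFin m)

  -- the (implicit or explicit) node of string S covers leaf (i', p)
  -- iff S is a prefix of the suffix of text i' starting at p
  Covers : List A → Leaf → Set
  Covers S (i' , p) = Prefix _≡_ (map chr S) (drop p (text i'))

  CoveredBy : (Fin m → List A) → Leaf → Set
  CoveredBy str l = ∃ λ i → Covers (str i) l

  coveredBy? : (str : Fin m → List A) → (l : Leaf) → Dec (CoveredBy str l)
  coveredBy? str (i' , p) = any? (λ i → prefix? _≟T_ (map chr (str i)) (drop p (text i')))

  coveredLeafCount : (Fin m → List A) → ℕ
  coveredLeafCount str = length (filter (coveredBy? str) leaves)

-- Every row i' of the alignment contributes its suffix at the start of column x to the covered
-- leaves, since it is covered by that row's own node. Hence W covers at least m leaves, and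
-- exactly m iff in every row that suffix is the only covered one, i.e. no spelled segment
-- occurs in any gaps-removed row except at the position of column x: semi-repeat-freeness.
module Submission where

open import Defs
open import Data.Nat using (ℕ; zero; suc; _+_; _≤_; _<_; _∸_; z≤n; s≤s)
open import Data.Nat.Properties using (≤-trans; +-mono-≤; +-comm; m≤n+m; n≮0; n≮n; suc-injective; m∸n≢0⇒n<m; n≤1+n)
open import Data.Nat.ListAction using (sum)
open import Data.Fin using (Fin; toℕ)
open import Data.List using (List; []; _∷_; _++_; [_]; map; take; drop; length; upTo; allFin; filter; concatMap)
open import Data.List.Properties using (filter-++; filter-some; length-++; length-map; length-drop; length-tabulate; map-cong; take++drop≡id)
open import Data.List.Membership.Propositional using (_∈_; lose)
open import Data.List.Membership.Propositional.Properties using (∈-upTo⁺; ∈-allFin; ∈-filter⁺; ∈-filter⁻)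
open import Data.List.Relation.Unary.Any using (here; there)
open import Data.List.Relation.Unary.All as All using (All; []; _∷_)
open import Data.List.Relation.Unary.All.Properties using (tabulate⁺)
open import Data.List.Relation.Unary.AllPairs using (_∷_)
open import Data.List.Relation.Unary.Unique.Propositional using (Unique)
open import Data.List.Relation.Unary.Unique.Propositional.Properties using (upTo⁺; filter⁺)
open import Data.List.Relation.Binary.Prefix.Heterogeneous as Prefix using (Prefix; []; _∷_; _++ᵖ_)
open import Data.List.Relation.Binary.Prefix.Heterogeneous.Properties using (length-mono; map⁺)
import Data.List.Relation.Binary.Pointwise as Pointwise
open import Data.Product using (_×_; _,_; proj₂)
open import Data.Bool using (true; false)
open import Data.Empty using (⊥-elim)
open import Relation.Nullary using (does)
open import Relation.Unary using (Decidable)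
open import Relation.Binary.PropositionalEquality using (_≡_; _≢_; refl; trans; cong; subst; module ≡-Reasoning)
import Relation.Binary.PropositionalEquality as ≡
open import Relation.Binary.Definitions using (DecidableEquality)
open import Function.Bundles using (_⇔_; mk⇔; Equivalence)

open Equivalence using (to; from)

spell-++ : {A : Set} (xs ys : List (Cell A)) → spell (xs ++ ys) ≡ spell xs ++ spell ys
spell-++ []           ys = refl
spell-++ (gap ∷ xs)   ys = spell-++ xs ys
spell-++ (sym a ∷ xs) ys = cong (a ∷_) (spell-++ xs ys)

OccursAt-++ : {A : Set} (xs S ys : List A) → OccursAt S (xs ++ S ++ ys) (length xs)
OccursAt-++ []       S ys = Prefix.fromView (Pointwise.refl refl Prefix.++ ys)
OccursAt-++ (_ ∷ xs) S ys = OccursAt-++ xs S ys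

OccursAt⇒<length : {A : Set} {S T : List A} {p : ℕ} → S ≢ [] → OccursAt S T p → p < length T
OccursAt⇒<length {S = []}    S≢[] _   = ⊥-elim (S≢[] refl)
OccursAt⇒<length {S = _ ∷ _} {T} {p} _ occ = m∸n≢0⇒n<m λ eq →
  n≮0 (subst (_ <_) (trans (length-drop p T) eq) (length-mono occ))

segment-OccursAt-startPos : {A : Set} {m n : ℕ} (M : MSA A m n) (i : Fin m) (x y : Fin n) →
  OccursAt (spell (segment M i x y)) (spellRow M i) (startPos M i x)
segment-OccursAt-startPos M i x y =
  subst (λ T → OccursAt S T (startPos M i x)) (≡.sym spellRow≡)
    (OccursAt-++ (spell (take (toℕ x) r)) S (spell (drop k d)))
  where
  open ≡-Reasoning
  r = row M i
  d = drop (toℕ x) r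
  k = suc (toℕ y) ∸ toℕ x
  S = spell (segment M i x y)

  spell-split : ∀ j (zs : List (Cell _)) → spell zs ≡ spell (take j zs) ++ spell (drop j zs)
  spell-split j zs = trans (cong spell (≡.sym (take++drop≡id j zs))) (spell-++ (take j zs) (drop j zs))

  spellRow≡ : spellRow M i ≡ spell (take (toℕ x) r) ++ S ++ spell (drop k d)
  spellRow≡ = begin
    spell r                                         ≡⟨ spell-split (toℕ x) r ⟩
    spell (take (toℕ x) r) ++ spell d               ≡⟨ cong (spell (take (toℕ x) r) ++_) (spell-split k d) ⟩
    spell (take (toℕ x) r) ++ S ++ spell (drop k d) ∎

module _ {A : Set} {m : ℕ} where

  -- The terminator stops any occurrence of a Σ-string from running off the end of the row.
  map-chr-Prefix-terminated⁻ : {S : List A} (T : List A) (j : Fin m) →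
    Prefix _≡_ (map chr S) (map chr T ++ [ term j ]) → Prefix _≡_ S T
  map-chr-Prefix-terminated⁻ {[]}    T       j _            = []
  map-chr-Prefix-terminated⁻ {_ ∷ _} []      j (() ∷ _)
  map-chr-Prefix-terminated⁻ {_ ∷ _} (_ ∷ T) j (refl ∷ pre) = refl ∷ map-chr-Prefix-terminated⁻ T j pre

  drop-map-chr-Prefix⇔ : {S : List A} (T : List A) (j : Fin m) (p : ℕ) →
    Prefix _≡_ (map chr S) (drop p (map chr T ++ [ term j ])) ⇔ Prefix _≡_ S (drop p T)
  drop-map-chr-Prefix⇔ T j p = mk⇔ (⇒ T p) (⇐ T p)
    where
    ⇒ : ∀ {S} T p → Prefix _≡_ (map chr S) (drop p (map chr T ++ [ term j ])) → Prefix _≡_ S (drop p T)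
    ⇒           T       zero          = map-chr-Prefix-terminated⁻ T j
    ⇒ {[]}      []      (suc p)       = λ _ → []
    ⇒ {_ ∷ _}   []      (suc zero)    = λ ()
    ⇒ {_ ∷ _}   []      (suc (suc p)) = λ ()
    ⇒           (_ ∷ T) (suc p)       = ⇒ T p

    ⇐ : ∀ {S} T p → Prefix _≡_ S (drop p T) → Prefix _≡_ (map chr S) (drop p (map chr T ++ [ term j ]))
    ⇐ T       zero    pre = map⁺ chr chr (Prefix.map (cong chr) pre) ++ᵖ [ term j ]
    ⇐ []      (suc p) []  = []
    ⇐ (_ ∷ T) (suc p) pre = ⇐ T p pre

length-filter-map : {B C : Set} {P : C → Set} (P? : Decidable P) (f : B → C) (xs : List B) →
  length (filter P? (map f xs)) ≡ length (filter (λ b → P? (f b)) xs)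
length-filter-map P? f [] = refl
length-filter-map P? f (x ∷ xs) with does (P? (f x))
... | true  = cong suc (length-filter-map P? f xs)
... | false = length-filter-map P? f xs

length-filter-concatMap : {B C : Set} {P : C → Set} (P? : Decidable P) (f : B → List C) (xs : List B) →
  length (filter P? (concatMap f xs)) ≡ sum (map (λ x → length (filter P? (f x))) xs)
length-filter-concatMap P? f [] = refl
length-filter-concatMap P? f (x ∷ xs) = begin
  length (filter P? (f x ++ concatMap f xs))                  ≡⟨ cong length (filter-++ P? (f x) _) ⟩
  length (filter P? (f x) ++ filter P? (concatMap f xs))      ≡⟨ length-++ (filter P? (f x)) ⟩
  length (filter P? (f x)) + length (filter P? (concatMap f xs))
    ≡⟨ cong (length (filter P? (f x)) +_) (length-filter-concatMap P? f xs) ⟩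
  sum (map (λ x → length (filter P? (f x))) (x ∷ xs))         ∎
  where open ≡-Reasoning

+≡suc⇒≡1 : ∀ {a s l} → 1 ≤ a → l ≤ s → a + s ≡ suc l → a ≡ 1 × s ≡ l
+≡suc⇒≡1 {suc zero}    _ _   eq = refl , suc-injective eq
+≡suc⇒≡1 {suc (suc k)} {s} _ l≤s eq =
  ⊥-elim (n≮n s (≤-trans (subst (s <_) (suc-injective eq) (s≤s (m≤n+m s k))) l≤s))

module _ {B : Set} (g : B → ℕ) where

  length≤sum : {xs : List B} → All (λ x → 1 ≤ g x) xs → length xs ≤ sum (map g xs)
  length≤sum []           = z≤n
  length≤sum (1≤gx ∷ pos) = +-mono-≤ 1≤gx (length≤sum pos)

  sum≡length⇔All≡1 : {xs : List B} → All (λ x → 1 ≤ g x) xs →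
    sum (map g xs) ≡ length xs ⇔ All (λ x → g x ≡ 1) xs
  sum≡length⇔All≡1 pos = mk⇔ (⇒ pos) ⇐
    where
    ⇒ : {xs : List B} → All (λ x → 1 ≤ g x) xs → sum (map g xs) ≡ length xs → All (λ x → g x ≡ 1) xs
    ⇒ []           _  = []
    ⇒ (1≤gx ∷ pos) eq with +≡suc⇒≡1 1≤gx (length≤sum pos) eq
    ... | gx≡1 , rest = gx≡1 ∷ ⇒ pos rest

    ⇐ : {xs : List B} → All (λ x → g x ≡ 1) xs → sum (map g xs) ≡ length xs
    ⇐ []                      = refl
    ⇐ {_ ∷ xs} (gx≡1 ∷ ones) = trans (cong (_+ sum (map g xs)) gx≡1) (cong suc (⇐ ones))

Unique-length≡1⇔ : {B : Set} {ys : List B} {a : B} → Unique ys → a ∈ ys →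
  length ys ≡ 1 ⇔ (∀ {b} → b ∈ ys → b ≡ a)
Unique-length≡1⇔ {ys = ys} uniq a∈ys = mk⇔ (⇒ ys a∈ys) (⇐ ys uniq a∈ys)
  where
  ⇒ : ∀ ys {a} → a ∈ ys → length ys ≡ 1 → ∀ {b} → b ∈ ys → b ≡ a
  ⇒ (_ ∷ []) (here refl) _ (here refl) = refl

  ⇐ : ∀ ys {a} → Unique ys → a ∈ ys → (∀ {b} → b ∈ ys → b ≡ a) → length ys ≡ 1
  ⇐ (_ ∷ [])     _                _ _    = refl
  ⇐ (_ ∷ _ ∷ _)  ((c≢d ∷ _) ∷ _)  _ only =
    ⊥-elim (c≢d (trans (only (here refl)) (≡.sym (only (there (here refl))))))

length-filter≡1⇔ : {B : Set} {Q : B → Set} (Q? : Decidable Q) {xs : List B} {a : B} →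
  Unique xs → a ∈ xs → Q a →
  length (filter Q? xs) ≡ 1 ⇔ (∀ {b} → b ∈ xs → Q b → b ≡ a)
length-filter≡1⇔ Q? {xs} {a} uniq a∈xs qa =
  mk⇔ (λ len≡1 {_} b∈xs qb → to only⇔ len≡1 (∈-filter⁺ Q? b∈xs qb))
      (λ only → from only⇔ λ {_} b∈ → let b∈xs , qb = ∈-filter⁻ Q? b∈ in only b∈xs qb)
  where
  only⇔ : length (filter Q? xs) ≡ 1 ⇔ (∀ {b} → b ∈ filter Q? xs → b ≡ a)
  only⇔ = Unique-length≡1⇔ (filter⁺ Q? uniq) (∈-filter⁺ Q? a∈xs qa)

module CoveredLeaves {A : Set} (_≟_ : DecidableEquality A) {m n : ℕ} (M : MSA A m n)
                     (x : Fin n) (y : Fin m → Fin n) (nonempty : ∀ i → spell (segment M i x (y i)) ≢ [])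
                     where

  open GST _≟_ M

  str : Fin m → List A
  str i = spell (segment M i x (y i))

  rowCoveredCount : Fin m → ℕ
  rowCoveredCount i' = length (filter (λ p → coveredBy? str (i' , p)) (upTo (length (text i'))))

  Covers⇔OccursAt : ∀ S i' p → Covers S (i' , p) ⇔ OccursAt S (spellRow M i') p
  Covers⇔OccursAt S i' p = drop-map-chr-Prefix⇔ (spellRow M i') i' p

  startPos-covered : ∀ i' → CoveredBy str (i' , startPos M i' x)
  startPos-covered i' =
    i' , from (Covers⇔OccursAt (str i') i' (startPos M i' x)) (segment-OccursAt-startPos M i' x (y i'))

  length-text : ∀ i' → length (text i') ≡ suc (length (spellRow M i'))
  length-text i' = trans (length-++ (map chr (spellRow M i')))
    (trans (cong (_+ 1) (length-map chr (spellRow M i'))) (+-comm _ 1))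

  covered⇒∈upTo : ∀ i' p → CoveredBy str (i' , p) → p ∈ upTo (length (text i'))
  covered⇒∈upTo i' p (i , cov) = ∈-upTo⁺ (subst (p <_) (≡.sym (length-text i'))
    (≤-trans (OccursAt⇒<length (nonempty i) (to (Covers⇔OccursAt (str i) i' p) cov)) (n≤1+n _)))

  startPos-∈upTo : ∀ i' → startPos M i' x ∈ upTo (length (text i'))
  startPos-∈upTo i' = covered⇒∈upTo i' (startPos M i' x) (startPos-covered i')

  rowCoveredCount≡1⇔ : ∀ i' →
    rowCoveredCount i' ≡ 1 ⇔ (∀ i p → OccursAt (str i) (spellRow M i') p → p ≡ startPos M i' x)
  rowCoveredCount≡1⇔ i' = mk⇔
    (λ len≡1 i p occ → to only⇔ len≡1 (covered⇒∈upTo i' p (i , cov i p occ)) (i , cov i p occ))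
    (λ only → from only⇔ λ {p} _ → λ { (i , c) → only i p (to (Covers⇔OccursAt (str i) i' p) c) })
    where
    only⇔ = length-filter≡1⇔ (λ p → coveredBy? str (i' , p)) (upTo⁺ _)
                             (startPos-∈upTo i') (startPos-covered i')
    cov : ∀ i p → OccursAt (str i) (spellRow M i') p → Covers (str i) (i' , p)
    cov i p = from (Covers⇔OccursAt (str i) i' p)

  coveredLeafCount≡sum : coveredLeafCount str ≡ sum (map rowCoveredCount (allFin m))
  coveredLeafCount≡sum = trans (length-filter-concatMap (coveredBy? str) _ (allFin m))
    (cong sum (map-cong row-wise (allFin m)))
    where
    row-wise : ∀ i' →
      length (filter (coveredBy? str) (map (i' ,_) (upTo (length (text i'))))) ≡ rowCoveredCount i'
    row-wise i' = length-filter-map (coveredBy? str) (i' ,_) (upTo (length (text i')))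

  coveredLeafCount≡m⇔ : coveredLeafCount str ≡ m ⇔ (∀ i' → rowCoveredCount i' ≡ 1)
  coveredLeafCount≡m⇔ = mk⇔
    (λ eq i' → All.lookup (to sum⇔ (trans (≡.sym coveredLeafCount≡sum) (trans eq (≡.sym length-allFin))))
                          (∈-allFin i'))
    (λ ones → trans coveredLeafCount≡sum (trans (from sum⇔ (tabulate⁺ ones)) length-allFin))
    where
    length-allFin : length (allFin m) ≡ m
    length-allFin = length-tabulate (λ i → i)
    rows-nonempty : ∀ i' → 1 ≤ rowCoveredCount i'
    rows-nonempty i' = filter-some (λ p → coveredBy? str (i' , p))
      (lose (startPos-∈upTo i') (startPos-covered i'))
    sum⇔ = sum≡length⇔All≡1 rowCoveredCount (tabulate⁺ rows-nonempty)

lemma3 : {A : Set} (_≟_ : DecidableEquality A) (m n : ℕ) (M : MSA A m n)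
    (x : Fin n) (y : Fin m → Fin n)
    → (∀ i → spell (segment M i x (y i)) ≢ [])
    → ((∀ i → SemiRepeatFree M i x (y i))
    ⇔ (GST.coveredLeafCount _≟_ M (λ i → spell (segment M i x (y i))) ≡ m))
lemma3 _≟_ m n M x y nonempty = mk⇔
  (λ srf → from coveredLeafCount≡m⇔ λ i' → from (rowCoveredCount≡1⇔ i') λ i p → proj₂ (srf i) i' p)
  (λ count≡m i → nonempty i , λ i' p → to (rowCoveredCount≡1⇔ i') (to coveredLeafCount≡m⇔ count≡m i') i p)
  where open CoveredLeaves _≟_ M x y nonempty
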